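{- Let $n\ge 11$ and $1\le d\le n-1$ be integers, let $N=T_{n,d}=\frac{n(n+1)}{2}-d$, and let $\lambda=(\lambda_1,\dots,\lambda_t)\in\mathbb U^*_N$. Then $\lambda_t\le 2n-2$ if $d$ is a part of $\lambda$, and $\lambda_t\le 2n-4$ if $d$ is not a part of $\lambda$.
   Context: A partition of $N$ into distinct parts is a sequence of positive integers $\lambda_1<\dots<\lambda_t$ summing to $N$ with $t\ge 2$. Its missing parts are the elements of $\{1,\dots,\lambda_t\}\setminus\{\lambda_1,\dots,\lambda_t\}$. $\lambda$ is refinable if two distinct missing parts sum to a part of $\lambda$, unrefinable otherwise; $\mathbb U_N$ is the set of unrefinable partitions of $N$. $\mathbb U^*_N$ is the set of maximal unrefinable partitions of $N$, i.e. those $\lambda\in\mathbb U_N$ whose largest part is the maximum of the largest parts over all of $\mathbb U_N$. Standing assumption in the paper: $n\ge 11$. -}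

module Defs where

open import Data.Nat using (ℕ; _+_; _*_; _∸_; _≤_; _<_; _⊔_; _/_)
open import Data.List using (List; length; foldr)
open import Data.Nat.ListAction using (sum)
open import Data.List.Relation.Unary.All using (All)
open import Data.List.Relation.Unary.AllPairs using (AllPairs)
open import Data.List.Membership.Propositional using (_∈_; _∉_)
open import Data.Product using (_×_; ∃; ∃-syntax)
open import Relation.Nullary using (¬_)
open import Relation.Binary.PropositionalEquality using (_≡_; _≢_)

StrictlyIncreasing : List ℕ → Set
StrictlyIncreasing = AllPairs _<_

-- Largest part λₜ (maximum of the parts; for a strictly increasing list
-- this is its last element).
largest : List ℕ → ℕ
largest = foldr _⊔_ 0

IsDistinctPartition : ℕ → List ℕ → Set
IsDistinctPartition N λs =
  StrictlyIncreasing λs × All (λ x → 1 ≤ x) λs × sum λs ≡ N × 2 ≤ length λs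

Missing : List ℕ → ℕ → Set
Missing λs m = 1 ≤ m × m ≤ largest λs × m ∉ λs

Refinable : List ℕ → Set
Refinable λs = ∃[ a ] ∃[ b ] (Missing λs a × Missing λs b × a ≢ b × (a + b) ∈ λs)

Unrefinable : ℕ → List ℕ → Set
Unrefinable N λs = IsDistinctPartition N λs × ¬ Refinable λs

MaximalUnrefinable : ℕ → List ℕ → Set
MaximalUnrefinable N λs =
  Unrefinable N λs × (∀ μ → Unrefinable N μ → largest μ ≤ largest λs)

T : ℕ → ℕ → ℕ
T n d = (n * (n + 1)) / 2 ∸ d

{-# OPTIONS --safe #-}
-- Let L be the largest part of an unrefinable partition λ. For every a with 2a < L,
-- a and L − a cannot both be missing (they would refine L), so one of them is a part.
-- Choosing for each a = 1, …, k (with 2k < L) such a part gives k distinct parts below L,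
-- the a-th of size at least a; hence L + k(k+1)/2 ≤ N. For N = T n d this forces L ≤ 2n − 2.
-- If moreover d ∉ λ, the part chosen for a = d is L − d instead of d, which improves the
-- estimate enough to force L ≤ 2n − 4.
module Submission where

open import Defs
open import Data.Nat using (ℕ; zero; suc; _+_; _*_; _∸_; _≤_; _<_; _/_; z≤n; s≤s)
open import Data.Nat.Properties
open import Data.Nat.DivMod using (m*n/n≡m)
open import Data.Nat.ListAction using (sum)
open import Data.Nat.Tactic.RingSolver using (solve-∀)
open import Data.List using (List; []; _∷_; length)
open import Data.List.Membership.Propositional using (_∈_; _∉_; _─_)
open import Data.List.Membership.DecPropositional _≟_ using (_∈?_)
open import Data.List.Relation.Unary.Any using (here; there)
open import Data.List.Relation.Unary.All using (All; []; _∷_)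
open import Data.List.Relation.Unary.AllPairs using (AllPairs; []; _∷_)
open import Data.Product using (_×_; _,_)
open import Data.Sum using (_⊎_; inj₁; inj₂)
open import Data.Empty using (⊥-elim)
open import Relation.Nullary using (¬_; yes; no; contradiction)
open import Relation.Binary.PropositionalEquality
open import Function using (_∘_)

triangle : ℕ → ℕ
triangle zero    = 0
triangle (suc k) = suc k + triangle k

triangle*2≡n*[n+1] : ∀ n → triangle n * 2 ≡ n * (n + 1)
triangle*2≡n*[n+1] zero    = refl
triangle*2≡n*[n+1] (suc n) = begin
  (suc n + triangle n) * 2        ≡⟨ *-distribʳ-+ 2 (suc n) (triangle n) ⟩
  suc n * 2 + triangle n * 2      ≡⟨ cong (suc n * 2 +_) (triangle*2≡n*[n+1] n) ⟩
  suc n * 2 + n * (n + 1)         ≡⟨ step n ⟩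
  suc n * (suc n + 1)             ∎
  where
  open ≡-Reasoning
  step : ∀ n → suc n * 2 + n * (n + 1) ≡ suc n * (suc n + 1)
  step = solve-∀

T≡triangle∸ : ∀ n d → T n d ≡ triangle n ∸ d
T≡triangle∸ n d = cong (_∸ d) (begin
  n * (n + 1) / 2        ≡⟨ cong (_/ 2) (triangle*2≡n*[n+1] n) ⟨
  triangle n * 2 / 2     ≡⟨ m*n/n≡m (triangle n) 2 ⟩
  triangle n             ∎)
  where open ≡-Reasoning

sum-─ : ∀ {x} xs (x∈xs : x ∈ xs) → sum xs ≡ x + sum (xs ─ x∈xs)
sum-─ (x ∷ xs) (here refl) = refl
sum-─ {x} (y ∷ xs) (there x∈xs) = begin
  y + sum xs                    ≡⟨ cong (y +_) (sum-─ xs x∈xs) ⟩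
  y + (x + sum (xs ─ x∈xs))     ≡⟨ +-assoc y x _ ⟨
  (y + x) + sum (xs ─ x∈xs)     ≡⟨ cong (_+ sum (xs ─ x∈xs)) (+-comm y x) ⟩
  (x + y) + sum (xs ─ x∈xs)     ≡⟨ +-assoc x y _ ⟩
  x + (y + sum (xs ─ x∈xs))     ∎
  where open ≡-Reasoning

∈-─ : ∀ {a} {A : Set a} {x y : A} xs (x∈xs : x ∈ xs) → y ∈ xs → y ≢ x → y ∈ xs ─ x∈xs
∈-─ (x ∷ xs) (here refl)  (here refl)  y≢x = contradiction refl y≢x
∈-─ (x ∷ xs) (here refl)  (there y∈xs) y≢x = y∈xs
∈-─ (z ∷ xs) (there x∈xs) (here refl)  y≢x = here refl
∈-─ (z ∷ xs) (there x∈xs) (there y∈xs) y≢x = there (∈-─ xs x∈xs y∈xs y≢x)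

distinct-⊆⇒sum-≤ : ∀ {xs} ys → AllPairs _≢_ ys → All (_∈ xs) ys → sum ys ≤ sum xs
distinct-⊆⇒sum-≤ []       _                _                = z≤n
distinct-⊆⇒sum-≤ {xs} (y ∷ ys) (y≢ys ∷ distinct) (y∈xs ∷ ys⊆xs) = begin
  y + sum ys              ≤⟨ +-monoʳ-≤ y (distinct-⊆⇒sum-≤ ys distinct (⊆-─ y≢ys ys⊆xs)) ⟩
  y + sum (xs ─ y∈xs)     ≡⟨ sum-─ xs y∈xs ⟨
  sum xs                  ∎
  where
  open ≤-Reasoning
  ⊆-─ : ∀ {zs} → All (y ≢_) zs → All (_∈ xs) zs → All (_∈ xs ─ y∈xs) zs
  ⊆-─ []            []            = []
  ⊆-─ (y≢z ∷ y≢zs) (z∈xs ∷ zs⊆xs) = ∈-─ xs y∈xs z∈xs (y≢z ∘ sym) ∷ ⊆-─ y≢zs zs⊆xs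

largest∈-∷ : ∀ x xs → largest (x ∷ xs) ∈ x ∷ xs
largest∈-∷ x []       = here (⊔-identityʳ x)
largest∈-∷ x (y ∷ ys) with ⊔-sel x (largest (y ∷ ys))
... | inj₁ x⊔m≡x = here x⊔m≡x
... | inj₂ x⊔m≡m = there (subst (_∈ y ∷ ys) (sym x⊔m≡m) (largest∈-∷ y ys))

largest∈ : ∀ {xs} → 1 ≤ length xs → largest xs ∈ xs
largest∈ {x ∷ xs} _ = largest∈-∷ x xs

m+n<o⇒m<o∸n : ∀ {a b L} → a + b < L → a < L ∸ b
m+n<o⇒m<o∸n {a} = m+n≤o⇒m≤o∸n (suc a)

module UnrefinablePartition (λs : List ℕ) (¬refinable : ¬ Refinable λs) (L∈λs : largest λs ∈ λs) where

  L : ℕ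
  L = largest λs

  m+m<L⇒m≤L : ∀ a → a + a < L → a ≤ L
  m+m<L⇒m≤L a a+a<L = ≤-trans (m≤m+n a a) (<⇒≤ a+a<L)

  ∉⇒complement∈ : ∀ {a} → 1 ≤ a → a + a < L → a ∉ λs → L ∸ a ∈ λs
  ∉⇒complement∈ {a} 1≤a a+a<L a∉λs with L ∸ a ∈? λs
  ... | yes L∸a∈λs = L∸a∈λs
  ... | no  L∸a∉λs = ⊥-elim (¬refinable (a , L ∸ a ,
          (1≤a , m+m<L⇒m≤L a a+a<L , a∉λs) ,
          (≤-trans 1≤a (<⇒≤ a<L∸a) , m∸n≤m L a , L∸a∉λs) ,
          <⇒≢ a<L∸a ,
          subst (_∈ λs) (sym (m+[n∸m]≡n (m+m<L⇒m≤L a a+a<L))) L∈λs))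
    where
    a<L∸a : a < L ∸ a
    a<L∸a = m+n<o⇒m<o∸n a+a<L

  representative : ℕ → ℕ
  representative a with a ∈? λs
  ... | yes _ = a
  ... | no  _ = L ∸ a

  representative-cases : ∀ a → (a ∈ λs × representative a ≡ a) ⊎ (a ∉ λs × representative a ≡ L ∸ a)
  representative-cases a with a ∈? λs
  ... | yes a∈λs = inj₁ (a∈λs , refl)
  ... | no  a∉λs = inj₂ (a∉λs , refl)

  representative∈ : ∀ {a} → 1 ≤ a → a + a < L → representative a ∈ λs
  representative∈ {a} 1≤a a+a<L with representative-cases a
  ... | inj₁ (a∈λs , r≡a)   rewrite r≡a = a∈λs
  ... | inj₂ (a∉λs , r≡L∸a) rewrite r≡L∸a = ∉⇒complement∈ 1≤a a+a<L a∉λs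

  ≤representative : ∀ {a} → a + a < L → a ≤ representative a
  ≤representative {a} a+a<L with representative-cases a
  ... | inj₁ (_ , r≡a)   rewrite r≡a = ≤-refl
  ... | inj₂ (_ , r≡L∸a) rewrite r≡L∸a = <⇒≤ (m+n<o⇒m<o∸n a+a<L)

  representative<L : ∀ {a} → 1 ≤ a → a + a < L → representative a < L
  representative<L {a} 1≤a a+a<L with representative-cases a
  ... | inj₁ (_ , r≡a)   rewrite r≡a = ≤-<-trans (m≤m+n a a) a+a<L
  ... | inj₂ (_ , r≡L∸a) rewrite r≡L∸a = ∸-monoʳ-< 1≤a (m+m<L⇒m≤L a a+a<L)

  representative-≢ : ∀ {a b} → b < a → a + a < L → representative a ≢ representative b
  representative-≢ {a} {b} b<a a+a<L with representative-cases a | representative-cases b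
  ... | inj₁ (_ , ra) | inj₁ (_ , rb) rewrite ra | rb = ≢-sym (<⇒≢ b<a)
  ... | inj₁ (_ , ra) | inj₂ (_ , rb) rewrite ra | rb =
    <⇒≢ (m+n<o⇒m<o∸n (≤-<-trans (+-monoʳ-≤ a (<⇒≤ b<a)) a+a<L))
  ... | inj₂ (_ , ra) | inj₁ (_ , rb) rewrite ra | rb = ≢-sym (<⇒≢ (<-trans b<a (m+n<o⇒m<o∸n a+a<L)))
  ... | inj₂ (_ , ra) | inj₂ (_ , rb) rewrite ra | rb = <⇒≢ (∸-monoʳ-< b<a (m+m<L⇒m≤L a a+a<L))

  representatives : ℕ → List ℕ
  representatives zero    = []
  representatives (suc k) = representative (suc k) ∷ representatives k

  +<-pred : ∀ k → suc k + suc k < L → k + k < L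
  +<-pred k = ≤-<-trans (+-mono-≤ (n≤1+n k) (n≤1+n k))

  representatives-⊆ : ∀ k → k + k < L → All (_∈ λs) (representatives k)
  representatives-⊆ zero    _        = []
  representatives-⊆ (suc k) 2[1+k]<L =
    representative∈ (s≤s z≤n) 2[1+k]<L ∷ representatives-⊆ k (+<-pred k 2[1+k]<L)

  representatives<L : ∀ k → k + k < L → All (L ≢_) (representatives k)
  representatives<L zero    _        = []
  representatives<L (suc k) 2[1+k]<L =
    ≢-sym (<⇒≢ (representative<L (s≤s z≤n) 2[1+k]<L)) ∷ representatives<L k (+<-pred k 2[1+k]<L)

  representatives-distinct : ∀ k → k + k < L → AllPairs _≢_ (representatives k)
  representatives-distinct zero    _        = []
  representatives-distinct (suc k) 2[1+k]<L =
    fresh k ≤-refl ∷ representatives-distinct k (+<-pred k 2[1+k]<L)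
    where
    fresh : ∀ j → j ≤ k → All (representative (suc k) ≢_) (representatives j)
    fresh zero    _     = []
    fresh (suc j) j≤k = representative-≢ (s≤s j≤k) 2[1+k]<L ∷ fresh j (≤-trans (n≤1+n j) j≤k)

  L+sum-representatives≤sum : ∀ k → k + k < L → L + sum (representatives k) ≤ sum λs
  L+sum-representatives≤sum k 2k<L = distinct-⊆⇒sum-≤ (L ∷ representatives k)
    (representatives<L k 2k<L ∷ representatives-distinct k 2k<L)
    (L∈λs ∷ representatives-⊆ k 2k<L)

  triangle≤sum-representatives : ∀ k → k + k < L → triangle k ≤ sum (representatives k)
  triangle≤sum-representatives zero    _        = z≤n
  triangle≤sum-representatives (suc k) 2[1+k]<L =
    +-mono-≤ (≤representative 2[1+k]<L) (triangle≤sum-representatives k (+<-pred k 2[1+k]<L))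

  -- the missing part d is represented by L ∸ d, which exceeds d by L ∸ 2d
  triangle+L≤sum-representatives+2d : ∀ k {d} → k + k < L → 1 ≤ d → d ≤ k → d ∉ λs →
    triangle k + L ≤ sum (representatives k) + (d + d)
  triangle+L≤sum-representatives+2d zero {suc _} _ _ () _
  triangle+L≤sum-representatives+2d (suc k) {d} 2[1+k]<L 1≤d d≤1+k d∉λs with m≤n⇒m<n∨m≡n d≤1+k
  ... | inj₁ (s≤s d≤k) = begin
    (suc k + triangle k) + L
      ≡⟨ +-assoc (suc k) _ _ ⟩
    suc k + (triangle k + L)
      ≤⟨ +-mono-≤ (≤representative 2[1+k]<L)
                  (triangle+L≤sum-representatives+2d k (+<-pred k 2[1+k]<L) 1≤d d≤k d∉λs) ⟩
    representative (suc k) + (sum (representatives k) + (d + d))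
      ≡⟨ +-assoc (representative (suc k)) _ _ ⟨
    sum (representatives (suc k)) + (d + d)
      ∎
    where open ≤-Reasoning
  ... | inj₂ refl with representative-cases d
  ...   | inj₁ (d∈λs , _)  = contradiction d∈λs d∉λs
  ...   | inj₂ (_ , r≡L∸d) = begin
    (d + triangle k) + L
      ≤⟨ +-monoʳ-≤ (d + triangle k) (m≤n+m∸n L d) ⟩
    (d + triangle k) + (d + (L ∸ d))
      ≡⟨ rearrange d (triangle k) (L ∸ d) ⟩
    ((L ∸ d) + triangle k) + (d + d)
      ≤⟨ +-monoˡ-≤ (d + d) (+-mono-≤ (≤-reflexive (sym r≡L∸d))
                                     (triangle≤sum-representatives k (+<-pred k 2[1+k]<L))) ⟩
    sum (representatives d) + (d + d)
      ∎
    where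
    open ≤-Reasoning
    rearrange : ∀ a t x → (a + t) + (a + x) ≡ (x + t) + (a + a)
    rearrange = solve-∀

  L+triangle≤sum : ∀ k → k + k < L → L + triangle k ≤ sum λs
  L+triangle≤sum k 2k<L =
    ≤-trans (+-monoʳ-≤ L (triangle≤sum-representatives k 2k<L)) (L+sum-representatives≤sum k 2k<L)

  L+[triangle+L]≤sum+2d : ∀ k {d} → k + k < L → 1 ≤ d → d ≤ k → d ∉ λs →
    L + (triangle k + L) ≤ sum λs + (d + d)
  L+[triangle+L]≤sum+2d k {d} 2k<L 1≤d d≤k d∉λs = begin
    L + (triangle k + L)                     ≤⟨ +-monoʳ-≤ L (triangle+L≤sum-representatives+2d k 2k<L 1≤d d≤k d∉λs) ⟩
    L + (sum (representatives k) + (d + d))  ≡⟨ +-assoc L _ _ ⟨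
    (L + sum (representatives k)) + (d + d)  ≤⟨ +-monoˡ-≤ (d + d) (L+sum-representatives≤sum k 2k<L) ⟩
    sum λs + (d + d)                         ∎
    where open ≤-Reasoning

2*[1+k]∸2≡k+k : ∀ k → 2 * suc k ∸ 2 ≡ k + k
2*[1+k]∸2≡k+k k = trans (cong (_∸ 2) (2*[1+k]≡k+k+2 k)) (m+n∸n≡m (k + k) 2)
  where
  2*[1+k]≡k+k+2 : ∀ k → 2 * suc k ≡ k + k + 2
  2*[1+k]≡k+k+2 = solve-∀

2*[2+k]∸4≡k+k : ∀ k → 2 * suc (suc k) ∸ 4 ≡ k + k
2*[2+k]∸4≡k+k k = trans (cong (_∸ 4) (2*[2+k]≡k+k+4 k)) (m+n∸n≡m (k + k) 4)
  where
  2*[2+k]≡k+k+4 : ∀ k → 2 * suc (suc k) ≡ k + k + 4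
  2*[2+k]≡k+k+4 = solve-∀

largest≤2n∸2 : ∀ {n d λs} → 1 ≤ n → 1 ≤ d → Unrefinable (T n d) λs → largest λs ≤ 2 * n ∸ 2
largest≤2n∸2 {suc k} {d} {λs} _ 1≤d ((_ , _ , sum≡T , 2≤length) , ¬refinable)
  rewrite 2*[1+k]∸2≡k+k k = ≮⇒≥ λ 2k<L → <⇒≱ 2k<L (≤-trans (L≤k 2k<L) (m≤m+n k k))
  where
  open UnrefinablePartition λs ¬refinable (largest∈ (≤-trans (n≤1+n 1) 2≤length))
  L≤k : k + k < L → L ≤ k
  L≤k 2k<L = +-cancelʳ-≤ (triangle k) L k (begin
    L + triangle k              ≤⟨ L+triangle≤sum k 2k<L ⟩
    sum λs                      ≡⟨ trans sum≡T (T≡triangle∸ (suc k) d) ⟩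
    suc k + triangle k ∸ d      ≤⟨ ∸-monoʳ-≤ (suc k + triangle k) 1≤d ⟩
    k + triangle k              ∎)
    where open ≤-Reasoning

largest≤2n∸4 : ∀ {n d λs} → 4 ≤ n → 1 ≤ d → d ≤ n ∸ 1 → d ∉ λs → Unrefinable (T n d) λs →
  largest λs ≤ 2 * n ∸ 4
largest≤2n∸4 {suc (suc k)} {d} {λs} (s≤s (s≤s 2≤k)) 1≤d d≤1+k d∉λs ((_ , _ , sum≡T , 2≤length) , ¬refinable)
  rewrite 2*[2+k]∸4≡k+k k = ≮⇒≥ λ 2k<L → <⇒≱ 2≤k (k≤1 2k<L)
  where
  open UnrefinablePartition λs ¬refinable (largest∈ (≤-trans (n≤1+n 1) 2≤length))
  t : ℕ
  t = triangle k

  sum≡ : sum λs ≡ triangle (2 + k) ∸ d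
  sum≡ = trans sum≡T (T≡triangle∸ (suc (suc k)) d)

  k≤1 : k + k < L → k ≤ 1
  k≤1 2k<L with m≤n⇒m<n∨m≡n d≤1+k
  ... | inj₁ (s≤s d≤k) = +-cancelˡ-≤ (t + (k + k + k + 2)) k 1 (begin
    t + (k + k + k + 2) + k                ≡⟨ lhs k t ⟩
    suc (k + k) + (t + suc (k + k))        ≤⟨ +-mono-≤ 2k<L (+-monoʳ-≤ t 2k<L) ⟩
    L + (t + L)                            ≤⟨ L+[triangle+L]≤sum+2d k 2k<L 1≤d d≤k d∉λs ⟩
    sum λs + (d + d)                       ≡⟨ cong (_+ (d + d)) sum≡ ⟩
    (triangle (2 + k) ∸ d) + (d + d)       ≡⟨ +-assoc (triangle (2 + k) ∸ d) d d ⟨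
    (triangle (2 + k) ∸ d + d) + d         ≡⟨ cong (_+ d) (m∸n+n≡m d≤triangle) ⟩
    triangle (2 + k) + d                   ≤⟨ +-monoʳ-≤ (triangle (2 + k)) d≤k ⟩
    triangle (2 + k) + k                   ≡⟨ rhs k t ⟩
    t + (k + k + k + 2) + 1                ∎)
    where
    open ≤-Reasoning
    d≤triangle : d ≤ triangle (2 + k)
    d≤triangle = ≤-trans (≤-trans d≤k (n≤1+n k)) (≤-trans (n≤1+n (suc k)) (m≤m+n _ _))
    lhs : ∀ k t → t + (k + k + k + 2) + k ≡ suc (k + k) + (t + suc (k + k))
    lhs = solve-∀
    rhs : ∀ k t → suc (suc k) + (suc k + t) + k ≡ t + (k + k + k + 2) + 1
    rhs = solve-∀
  ... | inj₂ refl = +-cancelˡ-≤ k k 1 (≤-pred (begin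
    suc (k + k)                   ≤⟨ 2k<L ⟩
    L                             ≤⟨ +-cancelʳ-≤ t L (suc (suc k)) L+t≤2+k+t ⟩
    suc (suc k)                   ≡⟨ cong suc (+-comm 1 k) ⟩
    suc (k + 1)                   ∎))
    where
    open ≤-Reasoning
    L+t≤2+k+t : L + t ≤ suc (suc k) + t
    L+t≤2+k+t = begin
      L + t                                       ≤⟨ L+triangle≤sum k 2k<L ⟩
      sum λs                                      ≡⟨ sum≡ ⟩
      (suc (suc k) + (suc k + t)) ∸ suc k         ≡⟨ cong (_∸ suc k) (regroup k t) ⟩
      (suc (suc k) + t) + suc k ∸ suc k           ≡⟨ m+n∸n≡m (suc (suc k) + t) (suc k) ⟩
      suc (suc k) + t                             ∎
      where
      regroup : ∀ k t → suc (suc k) + (suc k + t) ≡ (suc (suc k) + t) + suc k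
      regroup = solve-∀

proposition2p3 : ∀ (n d : ℕ) (λs : List ℕ) → 11 ≤ n → 1 ≤ d → d ≤ n ∸ 1 →
    MaximalUnrefinable (T n d) λs →
    (d ∈ λs → largest λs ≤ 2 * n ∸ 2) × (d ∉ λs → largest λs ≤ 2 * n ∸ 4)
proposition2p3 n d λs 11≤n 1≤d d≤n∸1 (unrefinable , _) =
  (λ _ → largest≤2n∸2 (≤-trans (s≤s z≤n) 11≤n) 1≤d unrefinable) ,
  (λ d∉λs → largest≤2n∸4 (≤-trans (s≤s (s≤s (s≤s (s≤s z≤n)))) 11≤n) 1≤d d≤n∸1 d∉λs unrefinable)
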